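{- Fix integers $L,R\ge0$ and a bit string $I^0\in\{0,1\}^{\mathbb Z}$, and define $I^1\in\{0,1\}^{\mathbb Z}$ by $I^1(2x)=I^1(2x+1)=I^0(x)$ for all $x\in\mathbb Z$. Let $\mathrm{CA}^0=\mathrm{CA}_{2,L,R,0}$ with initial configuration $\mathrm{CA}^0(\cdot,0)=I^0$ and $\mathrm{CA}^1=\mathrm{CA}_{2,2L,2R,0}$ with initial configuration $\mathrm{CA}^1(\cdot,0)=I^1$. Let $u\in\mathbb Z$, $v\in\mathbb Z_{\ge0}$, $h\in\mathbb Z_{>0}$, let $T_1$ be the play-triangle with base $\{(u-h+1,v),\dots,(u,v)\}$ (i.e. $T_1=T(u,v,h)$), and let $T_2$ be the play-triangle with base $\{(2(u-h)+2,0),\dots,(2u,0)\}$ if $v=0$ (i.e. $T_2=T(2u,0,2h-1)$), and with base $\{(2(u-h)+1,2v-1),\dots,(2u,2v-1)\}$ if $v\ge1$ (i.e. $T_2=T(2u,2v-1,2h)$). Then $T_1$ is $\mathrm{CA}^0$-safe (with parameters $L,R$) if and only if $T_2$ is $\mathrm{CA}^1$-safe (with parameters $2L,2R$).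
   Context: For integers $L,R\ge0$ and initial configuration $\mathrm{CA}(\cdot,0)$, the automaton $\mathrm{CA}_{2,L,R,0}$ is defined for $t\ge1$ by: $\mathrm{CA}(x,t)=0$ if $\mathrm{CA}(x-1,t-1)+\mathrm{CA}(x,t-1)=0$ or $\mathrm{CA}(x-1-L,t-1)+\dots+\mathrm{CA}(x+R,t-1)\ge 2+L+R$ (i.e. all these cells are $1$); otherwise $\mathrm{CA}(x,t)=1$. For $t\ge1$ let $w_1(x,t)$ be the multiset $\{\mathrm{CA}(x-1-L,t-1),\dots,\mathrm{CA}(x+R,t-1)\}$ and $|w_1(x,t)|_0$ its number of zeros. A (right-angle isosceles) play-triangle is $T(x,y,h)=\bigcup_{i=1}^h\{(x-i+1,\,y+h-i),\dots,(x,\,y+h-i)\}$ for $x\in\mathbb Z$, $y\in\mathbb Z_{\ge0}$, $h\ge1$; its base is $\{(x-h+1,y),\dots,(x,y)\}$. A play-triangle $T$ is CA-safe with respect to such an automaton if $\mathrm{CA}(p)=0$ for all $p\in T$ and, when the base is at level $y\ge1$, $|w_1(p)|_0=0$ (i.e. $\le B=0$) for every base cell $p$; when the base is at level $0$ the second condition is vacuous. -}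

module Defs where

open import Data.Bool using (Bool; true; false; _∧_; _∨_; not)
open import Data.Nat as ℕ using (ℕ; zero; suc)
open import Data.Integer as ℤ using (ℤ; +_; _+_; _-_)
open import Data.Product using (Σ; _×_; ∃-syntax)
open import Relation.Binary.PropositionalEquality using (_≡_)

-- Configurations: ℤ → Bool (true = 1, false = 0); time is ℕ.
Config : Set
Config = ℤ → Bool

window : Config → ℤ → ℕ → ℕ
window c s zero    = 0
window c s (suc n) with c s
... | true  = window c (s + + 1) n
... | false = suc (window c (s + + 1) n)

-- |w_1(x,t)|_0 computed from the configuration c = CA(·,t-1):
-- number of zeros among c(x-1-L), ..., c(x+R)  (L+R+2 cells)
zerosW1 : ℕ → ℕ → Config → ℤ → ℕ
zerosW1 L R c x = window c (x - + 1 - + L) (2 ℕ.+ L ℕ.+ R)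

allOnesW1 : ℕ → ℕ → Config → ℤ → Bool
allOnesW1 L R c x with zerosW1 L R c x
... | zero  = true
... | suc _ = false

step : ℕ → ℕ → Config → Config
step L R c x with c (x - + 1) ∨ c x
... | false = false
... | true  = not (allOnesW1 L R c x)

CA : ℕ → ℕ → Config → ℤ → ℕ → Bool
CA L R I x zero    = I x
CA L R I x (suc t) = step L R (λ z → CA L R I z t) x

-- (a,b) ∈ T(x,y,h): row j = h-i (0 ≤ j < h) at level y+j consists of
-- cells x-h+1+j, ..., x
InTriangle : ℤ → ℕ → ℕ → ℤ → ℕ → Set
InTriangle x y h a b =
  ∃[ j ] (j ℕ.< h × b ≡ y ℕ.+ j × (x - + h + + 1 + + j) ℤ.≤ a × a ℤ.≤ x)

CASafe : ℕ → ℕ → Config → ℤ → ℕ → ℕ → Set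
CASafe L R I x y h =
  (∀ a b → InTriangle x y h a b → CA L R I a b ≡ false) ×
  (∀ y' → y ≡ suc y' → ∀ a → (x - + h + + 1) ℤ.≤ a → a ℤ.≤ x →
     zerosW1 L R (λ z → CA L R I z y') a ≡ 0)

module Submission where

-- Run on the doubled configuration, CA_{2,2L,2R,0} simulates CA_{2,L,R,0} at half speed. At time 2t
-- its configuration is the doubling of CA(·,t); at time 2t+1 its even cells 2y already hold CA(y,t+1)
-- while its odd cells 2y+1 hold CA(y,t) ∧ ¬(CA(y-L,t) = … = CA(y+R,t) = 1). A window of width 2(L+R+1)
-- at 2y sees exactly the window of width L+R+2 at y, and the windows met at odd times always contain a
-- zero, so both rules agree. Safety then transfers between T₁ and T₂ cell by cell after splitting the
-- offsets of T₂ by parity; the only odd cells of T₂ not matched by a zero cell of T₁ lie on its bottom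
-- row 2v-1, and there the full base windows of T₁ force them to 0.

open import Algebra.Bundles using (CommutativeMonoid)
open import Data.Bool using (Bool; true; false; _∧_; _∨_; not)
open import Data.Bool.Properties
  using (∧-assoc; ∧-idem; ∧-zeroʳ; ∧-identityʳ; ∧-conicalˡ; ∨-idem; ∨-identityʳ;
         ∧-commutativeMonoid)
open import Data.Integer using (ℤ; +_; _+_; _-_; 0ℤ; +≤+)
import Data.Integer as ℤ
import Data.Integer.Properties as ℤP
open import Data.Integer.Tactic.RingSolver using (solve-∀)
open import Data.List using (_∷_; [])
open import Data.Nat using (ℕ; zero; suc; _≤_; _<_; _*_; _∸_; _≡ᵇ_; s≤s; s≤s⁻¹; z≤n)
import Data.Nat as ℕ
import Data.Nat.Properties as ℕP
open import Data.Nat.Tactic.RingSolver using (solve)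
open import Data.Product using (_×_; _,_; proj₁; proj₂; ∃-syntax)
open import Function.Base using (_∘_)
open import Function.Bundles using (_⇔_; mk⇔; Equivalence)
open import Relation.Binary.PropositionalEquality
  using (_≡_; refl; sym; trans; cong; cong₂; subst; module ≡-Reasoning)
open import Algebra.Properties.CommutativeSemigroup
  (CommutativeMonoid.commutativeSemigroup ∧-commutativeMonoid) using (interchange)

open import Defs

open ≡-Reasoning
open Equivalence using (to; from)

∧-false : ∀ a {b} → (a ≡ true → b ≡ false) → a ∧ b ≡ false
∧-false true  a⇒b = a⇒b refl
∧-false false _   = refl

∧-interleave : ∀ a b c d → a ∧ (b ∧ (c ∧ d)) ≡ (a ∧ c) ∧ (b ∧ d)
∧-interleave a b c d = trans (sym (∧-assoc a b (c ∧ d))) (interchange a b c d)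

-- With a, b = d (y - 1), d y and x, z = nbhd d (y - 1), nbhd d y, the common value is step L R d y
-- (step≡split) and the absorbed disjuncts are intermediate d (y - 1) and intermediate d y.
step-absorbs-left : ∀ a b x z →
  (a ∧ not x) ∨ ((a ∨ b) ∧ not (x ∧ z)) ≡ (a ∨ b) ∧ not (x ∧ z)
step-absorbs-left false b x     z = refl
step-absorbs-left true  b true  z = refl
step-absorbs-left true  b false z = refl

step-absorbs-right : ∀ a b x z →
  ((a ∨ b) ∧ not (x ∧ z)) ∨ (b ∧ not z) ≡ (a ∨ b) ∧ not (x ∧ z)
step-absorbs-right a     false x     z     = ∨-identityʳ _
step-absorbs-right a     true  x     true  = ∨-identityʳ _
step-absorbs-right false true  false false = refl
step-absorbs-right false true  true  false = refl
step-absorbs-right true  true  false false = refl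
step-absorbs-right true  true  true  false = refl

data EvenOdd : ℕ → Set where
  even : ∀ q → EvenOdd (2 * q)
  odd  : ∀ q → EvenOdd (suc (2 * q))

evenOdd : ∀ n → EvenOdd n
evenOdd zero = even 0
evenOdd (suc n) with evenOdd n
... | even q = odd q
... | odd  q = subst EvenOdd (ℕP.*-suc 2 q) (even (suc q))

halve : ∀ m {n h} → n < 2 * h → ∀ r → 2 * m ℕ.+ r ≡ n → m < h
halve m {n} {h} n<2h r 2m+r≡n =
  ℕP.*-cancelˡ-< 2 m h
    (ℕP.≤-<-trans (ℕP.≤-trans (ℕP.m≤m+n (2 * m) r) (ℕP.≤-reflexive 2m+r≡n)) n<2h)

suc-double-< : ∀ {m h} → m < h → suc (2 * m) < 2 * h
suc-double-< {m} {h} m<h = subst (_≤ 2 * h) (ℕP.*-suc 2 m) (ℕP.*-monoʳ-≤ 2 m<h)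

n<1+2h⇒1+n<2[1+h] : ∀ {n h} → n < suc (2 * h) → suc n < 2 * suc h
n<1+2h⇒1+n<2[1+h] {n} {h} n<1+2h = subst (suc n <_) (sym (ℕP.*-suc 2 h)) (s≤s n<1+2h)

1+2v+[1+2a]≡2[1+v+a] : ∀ v a → suc (2 * v) ℕ.+ suc (2 * a) ≡ 2 * (suc v ℕ.+ a)
1+2v+[1+2a]≡2[1+v+a] v a = solve (v ∷ a ∷ [])

1+2v+2a≡1+2[v+a] : ∀ v a → suc (2 * v) ℕ.+ 2 * a ≡ suc (2 * (v ℕ.+ a))
1+2v+2a≡1+2[v+a] v a = cong suc (sym (ℕP.*-distribˡ-+ 2 v a))

2[1+n]∸1≡1+2n : ∀ n → 2 * suc n ∸ 1 ≡ suc (2 * n)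
2[1+n]∸1≡1+2n n = cong (_∸ 1) (ℕP.*-suc 2 n)

2y-1≡2[y-1]+1 : ∀ y → + 2 ℤ.* y - + 1 ≡ + 2 ℤ.* (y - + 1) + + 1
2y-1≡2[y-1]+1 = solve-∀

2y+1-1≡2y : ∀ y → + 2 ℤ.* y + + 1 - + 1 ≡ + 2 ℤ.* y
2y+1-1≡2y = solve-∀

2y-1-2l≡2[y-1-l]+1 : ∀ y l → + 2 ℤ.* y - + 1 - + 2 ℤ.* l ≡ + 2 ℤ.* (y - + 1 - l) + + 1
2y-1-2l≡2[y-1-l]+1 = solve-∀

2y+1-1-2l≡2[y-l] : ∀ y l → + 2 ℤ.* y + + 1 - + 1 - + 2 ℤ.* l ≡ + 2 ℤ.* (y - l)
2y+1-1-2l≡2[y-l] = solve-∀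

2s+1+1≡2[s+1] : ∀ s → + 2 ℤ.* s + + 1 + + 1 ≡ + 2 ℤ.* (s + + 1)
2s+1+1≡2[s+1] = solve-∀

y-1-l+1≡y-l : ∀ y l → y - + 1 - l + + 1 ≡ y - l
y-1-l+1≡y-l = solve-∀

y-l+l≡y : ∀ y l → y - l + l ≡ y
y-l+l≡y = solve-∀

2u-2b≡2[u-b] : ∀ u b → + 2 ℤ.* u - + 2 ℤ.* b ≡ + 2 ℤ.* (u - b)
2u-2b≡2[u-b] = solve-∀

2u-[1+2b]≡2[u-[1+b]]+1 : ∀ u b → + 2 ℤ.* u - (+ 1 + + 2 ℤ.* b) ≡ + 2 ℤ.* (u - (+ 1 + b)) + + 1
2u-[1+2b]≡2[u-[1+b]]+1 = solve-∀

u-[1+b]≡u-b-1 : ∀ u b → u - (+ 1 + b) ≡ u - b - + 1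
u-[1+b]≡u-b-1 = solve-∀

a≡x-[x-a] : ∀ x a → a ≡ x - (x - a)
a≡x-[x-a] = solve-∀

[x-k]-[x-h+1+j]≡h-[1+j+k] : ∀ x h j k → (x - k) - (x - h + + 1 + j) ≡ h - (+ 1 + (j + k))
[x-k]-[x-h+1+j]≡h-[1+j+k] = solve-∀

even-position : ∀ u b → + 2 ℤ.* u - + (2 * b) ≡ + 2 ℤ.* (u - + b)
even-position u b = trans (cong (+ 2 ℤ.* u -_) (ℤP.pos-* 2 b)) (2u-2b≡2[u-b] u (+ b))

odd-position : ∀ u b → + 2 ℤ.* u - + suc (2 * b) ≡ + 2 ℤ.* (u - + suc b) + + 1
odd-position u b =
  trans (cong (λ z → + 2 ℤ.* u - (+ 1 + z)) (ℤP.pos-* 2 b)) (2u-[1+2b]≡2[u-[1+b]]+1 u (+ b))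

allOnes : Config → ℤ → ℕ → Bool
allOnes c s zero    = true
allOnes c s (suc n) = c s ∧ allOnes c (s + + 1) n

window≡ᵇ0 : ∀ c s n → (window c s n ≡ᵇ 0) ≡ allOnes c s n
window≡ᵇ0 c s zero = refl
window≡ᵇ0 c s (suc n) with c s
... | true  = window≡ᵇ0 c (s + + 1) n
... | false = refl

allOnesW1≡allOnes : ∀ L R c x → allOnesW1 L R c x ≡ allOnes c (x - + 1 - + L) (2 ℕ.+ L ℕ.+ R)
allOnesW1≡allOnes L R c x with zerosW1 L R c x | window≡ᵇ0 c (x - + 1 - + L) (2 ℕ.+ L ℕ.+ R)
... | zero  | eq = eq
... | suc _ | eq = eq

zerosW1≡0⇔ : ∀ L R c x → zerosW1 L R c x ≡ 0 ⇔ allOnesW1 L R c x ≡ true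
zerosW1≡0⇔ L R c x with zerosW1 L R c x
... | zero  = mk⇔ (λ _ → refl) (λ _ → refl)
... | suc _ = mk⇔ (λ ()) (λ ())

step≡ : ∀ L R c x → step L R c x ≡ (c (x - + 1) ∨ c x) ∧ not (allOnesW1 L R c x)
step≡ L R c x with c (x - + 1) ∨ c x
... | true  = refl
... | false = refl

allOnes-∧ : ∀ f g s n → allOnes (λ y → f y ∧ g y) s n ≡ allOnes f s n ∧ allOnes g s n
allOnes-∧ f g s zero    = refl
allOnes-∧ f g s (suc n) =
  trans (cong ((f s ∧ g s) ∧_) (allOnes-∧ f g (s + + 1) n)) (interchange (f s) (g s) _ _)

allOnes-false : ∀ c s {k n} → k < n → c (s + + k) ≡ false → allOnes c s n ≡ false
allOnes-false c s {zero}  {suc n} _          cs≡false =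
  cong (_∧ allOnes c (s + + 1) n) (trans (cong c (sym (ℤP.+-identityʳ s))) cs≡false)
allOnes-false c s {suc k} {suc n} (s≤s k<n) cs≡false = trans
  (cong (c s ∧_) (allOnes-false c (s + + 1) k<n (trans (cong c (ℤP.+-assoc s (+ 1) (+ k))) cs≡false)))
  (∧-zeroʳ (c s))

allOnes-prefix : ∀ c s n → allOnes c s n ∧ allOnes c s (suc n) ≡ allOnes c s (suc n)
allOnes-prefix c s zero = refl
allOnes-prefix c s (suc n) with c s
... | true  = allOnes-prefix c (s + + 1) n
... | false = refl

allOnes-overlap : ∀ c s n →
  allOnes c s (suc n) ∧ allOnes c (s + + 1) (suc n) ≡ allOnes c s (suc (suc n))
allOnes-overlap c s n =
  trans (∧-assoc (c s) _ _) (cong (c s ∧_) (allOnes-prefix c (s + + 1) n))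

record Interleaves (c f g : Config) : Set where
  constructor interleaves
  field
    on-even : ∀ y → c (+ 2 ℤ.* y) ≡ f y
    on-odd  : ∀ y → c (+ 2 ℤ.* y + + 1) ≡ g y

open Interleaves

interleaved-at-even : ∀ {c f g} → Interleaves c f g → ∀ u b →
  c (+ 2 ℤ.* u - + (2 * b)) ≡ f (u - + b)
interleaved-at-even {c} il u b = trans (cong c (even-position u b)) (on-even il (u - + b))

interleaved-at-odd : ∀ {c f g} → Interleaves c f g → ∀ u b →
  c (+ 2 ℤ.* u - + suc (2 * b)) ≡ g (u - + suc b)
interleaved-at-odd {c} il u b = trans (cong c (odd-position u b)) (on-odd il (u - + suc b))

allOnes-interleaved-even : ∀ {c f g} → Interleaves c f g → ∀ s n →
  allOnes c (+ 2 ℤ.* s) (2 * n) ≡ allOnes f s n ∧ allOnes g s n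
allOnes-interleaved-even il s zero = refl
allOnes-interleaved-even {c} {f} {g} il s (suc n) = begin
  allOnes c (+ 2 ℤ.* s) (2 * suc n)
    ≡⟨ cong (allOnes c (+ 2 ℤ.* s)) (ℕP.*-suc 2 n) ⟩
  c (+ 2 ℤ.* s) ∧ (c (+ 2 ℤ.* s + + 1) ∧ allOnes c (+ 2 ℤ.* s + + 1 + + 1) (2 * n))
    ≡⟨ cong₂ _∧_ (on-even il s) (cong₂ _∧_ (on-odd il s) (trans
         (cong (λ z → allOnes c z (2 * n)) (2s+1+1≡2[s+1] s))
         (allOnes-interleaved-even il (s + + 1) n))) ⟩
  f s ∧ (g s ∧ (allOnes f (s + + 1) n ∧ allOnes g (s + + 1) n))
    ≡⟨ ∧-interleave (f s) (g s) _ _ ⟩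
  allOnes f s (suc n) ∧ allOnes g s (suc n) ∎

allOnes-interleaved-odd : ∀ {c f g} → Interleaves c f g → ∀ s n →
  allOnes c (+ 2 ℤ.* s + + 1) (2 * n) ≡ allOnes g s n ∧ allOnes f (s + + 1) n
allOnes-interleaved-odd il s zero = refl
allOnes-interleaved-odd {c} {f} {g} il s (suc n) = begin
  allOnes c (+ 2 ℤ.* s + + 1) (2 * suc n)
    ≡⟨ cong (allOnes c (+ 2 ℤ.* s + + 1)) (ℕP.*-suc 2 n) ⟩
  c (+ 2 ℤ.* s + + 1) ∧ (c (+ 2 ℤ.* s + + 1 + + 1) ∧ allOnes c (+ 2 ℤ.* s + + 1 + + 1 + + 1) (2 * n))
    ≡⟨ cong₂ _∧_ (on-odd il s) (cong₂ _∧_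
         (trans (cong c (2s+1+1≡2[s+1] s)) (on-even il (s + + 1)))
         (trans (cong (λ z → allOnes c (z + + 1) (2 * n)) (2s+1+1≡2[s+1] s))
                (allOnes-interleaved-odd il (s + + 1) n))) ⟩
  g s ∧ (f (s + + 1) ∧ (allOnes g (s + + 1) n ∧ allOnes f (s + + 1 + + 1) n))
    ≡⟨ ∧-interleave (g s) (f (s + + 1)) _ _ ⟩
  allOnes g s (suc n) ∧ allOnes f (s + + 1) (suc n) ∎

module Rule (L R : ℕ) where

  nbhd : Config → ℤ → Bool
  nbhd d y = allOnes d (y - + L) (suc (L ℕ.+ R))

  -- At odd times the doubled automaton holds step L R d on the even cells and this on the odd ones.
  intermediate : Config → Config
  intermediate d y = d y ∧ not (nbhd d y)

  allOnesW1-split : ∀ d y → allOnesW1 L R d y ≡ nbhd d (y - + 1) ∧ nbhd d y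
  allOnesW1-split d y = begin
    allOnesW1 L R d y
      ≡⟨ allOnesW1≡allOnes L R d y ⟩
    allOnes d (y - + 1 - + L) (suc (suc (L ℕ.+ R)))
      ≡⟨ sym (allOnes-overlap d _ (L ℕ.+ R)) ⟩
    nbhd d (y - + 1) ∧ allOnes d (y - + 1 - + L + + 1) (suc (L ℕ.+ R))
      ≡⟨ cong (λ s → nbhd d (y - + 1) ∧ allOnes d s (suc (L ℕ.+ R))) (y-1-l+1≡y-l y (+ L)) ⟩
    nbhd d (y - + 1) ∧ nbhd d y ∎

  allOnesW1⇒nbhd-pred : ∀ d y → allOnesW1 L R d y ≡ true → nbhd d (y - + 1) ≡ true
  allOnesW1⇒nbhd-pred d y full = ∧-conicalˡ _ _ (trans (sym (allOnesW1-split d y)) full)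

  step≡split : ∀ d y → step L R d y ≡ (d (y - + 1) ∨ d y) ∧ not (nbhd d (y - + 1) ∧ nbhd d y)
  step≡split d y = trans (step≡ L R d y) (cong (λ w → (d (y - + 1) ∨ d y) ∧ not w) (allOnesW1-split d y))

  -- y lies in its own neighbourhood, and intermediate d y = true requires nbhd d y = false.
  nbhd-intermediate : ∀ d y → nbhd (intermediate d) y ≡ false
  nbhd-intermediate d y = trans (allOnes-∧ d (λ z → not (nbhd d z)) (y - + L) (suc (L ℕ.+ R)))
    (∧-false (nbhd d y) λ full →
      allOnes-false (λ z → not (nbhd d z)) (y - + L) (s≤s (ℕP.m≤m+n L R))
        (cong not (trans (cong (nbhd d) (y-l+l≡y y (+ L))) full)))

  width₂ : 2 ℕ.+ 2 * L ℕ.+ 2 * R ≡ 2 * suc (L ℕ.+ R)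
  width₂ = solve (L ∷ R ∷ [])

  allOnesW1-interleaved-even : ∀ {c f g} → Interleaves c f g → ∀ y →
    allOnesW1 (2 * L) (2 * R) c (+ 2 ℤ.* y) ≡ nbhd g (y - + 1) ∧ nbhd f y
  allOnesW1-interleaved-even {c} {f} {g} il y = begin
    allOnesW1 (2 * L) (2 * R) c (+ 2 ℤ.* y)
      ≡⟨ allOnesW1≡allOnes (2 * L) (2 * R) c (+ 2 ℤ.* y) ⟩
    allOnes c (+ 2 ℤ.* y - + 1 - + (2 * L)) (2 ℕ.+ 2 * L ℕ.+ 2 * R)
      ≡⟨ cong₂ (allOnes c) start width₂ ⟩
    allOnes c (+ 2 ℤ.* (y - + 1 - + L) + + 1) (2 * suc (L ℕ.+ R))
      ≡⟨ allOnes-interleaved-odd il (y - + 1 - + L) (suc (L ℕ.+ R)) ⟩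
    nbhd g (y - + 1) ∧ allOnes f (y - + 1 - + L + + 1) (suc (L ℕ.+ R))
      ≡⟨ cong (λ s → nbhd g (y - + 1) ∧ allOnes f s (suc (L ℕ.+ R))) (y-1-l+1≡y-l y (+ L)) ⟩
    nbhd g (y - + 1) ∧ nbhd f y ∎
    where
    start = trans (cong (+ 2 ℤ.* y - + 1 -_) (ℤP.pos-* 2 L)) (2y-1-2l≡2[y-1-l]+1 y (+ L))

  allOnesW1-interleaved-odd : ∀ {c f g} → Interleaves c f g → ∀ y →
    allOnesW1 (2 * L) (2 * R) c (+ 2 ℤ.* y + + 1) ≡ nbhd f y ∧ nbhd g y
  allOnesW1-interleaved-odd {c} {f} {g} il y = begin
    allOnesW1 (2 * L) (2 * R) c (+ 2 ℤ.* y + + 1)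
      ≡⟨ allOnesW1≡allOnes (2 * L) (2 * R) c (+ 2 ℤ.* y + + 1) ⟩
    allOnes c (+ 2 ℤ.* y + + 1 - + 1 - + (2 * L)) (2 ℕ.+ 2 * L ℕ.+ 2 * R)
      ≡⟨ cong₂ (allOnes c) start width₂ ⟩
    allOnes c (+ 2 ℤ.* (y - + L)) (2 * suc (L ℕ.+ R))
      ≡⟨ allOnes-interleaved-even il (y - + L) (suc (L ℕ.+ R)) ⟩
    nbhd f y ∧ nbhd g y ∎
    where
    start = trans (cong (+ 2 ℤ.* y + + 1 - + 1 -_) (ℤP.pos-* 2 L)) (2y+1-1-2l≡2[y-l] y (+ L))

  allOnesW1-doubled-even : ∀ {c d} → Interleaves c d d → ∀ y →
    allOnesW1 (2 * L) (2 * R) c (+ 2 ℤ.* y) ≡ allOnesW1 L R d y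
  allOnesW1-doubled-even {d = d} il y =
    trans (allOnesW1-interleaved-even il y) (sym (allOnesW1-split d y))

  allOnesW1-doubled-odd : ∀ {c d} → Interleaves c d d → ∀ y →
    allOnesW1 (2 * L) (2 * R) c (+ 2 ℤ.* y + + 1) ≡ nbhd d y
  allOnesW1-doubled-odd {d = d} il y = trans (allOnesW1-interleaved-odd il y) (∧-idem (nbhd d y))

  step-interleaved-even : ∀ {c f g} → Interleaves c f g → ∀ y →
    step (2 * L) (2 * R) c (+ 2 ℤ.* y) ≡ (g (y - + 1) ∨ f y) ∧ not (nbhd g (y - + 1) ∧ nbhd f y)
  step-interleaved-even {c} il y = trans (step≡ (2 * L) (2 * R) c _)
    (cong₂ (λ a w → a ∧ not w) (cong₂ _∨_ left (on-even il y)) (allOnesW1-interleaved-even il y))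
    where
    left = trans (cong c (2y-1≡2[y-1]+1 y)) (on-odd il (y - + 1))

  step-interleaved-odd : ∀ {c f g} → Interleaves c f g → ∀ y →
    step (2 * L) (2 * R) c (+ 2 ℤ.* y + + 1) ≡ (f y ∨ g y) ∧ not (nbhd f y ∧ nbhd g y)
  step-interleaved-odd {c} il y = trans (step≡ (2 * L) (2 * R) c _)
    (cong₂ (λ a w → a ∧ not w) (cong₂ _∨_ left (on-odd il y)) (allOnesW1-interleaved-odd il y))
    where
    left = trans (cong c (2y+1-1≡2y y)) (on-even il y)

  step-doubled : ∀ {c d} → Interleaves c d d →
    Interleaves (step (2 * L) (2 * R) c) (step L R d) (intermediate d)
  step-doubled {d = d} il = interleaves
    (λ y → trans (step-interleaved-even il y) (sym (step≡split d y)))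
    (λ y → trans (step-interleaved-odd il y)
                 (cong₂ (λ a w → a ∧ not w) (∨-idem (d y)) (∧-idem (nbhd d y))))

  step-intermediate : ∀ {e d} → Interleaves e (step L R d) (intermediate d) →
    Interleaves (step (2 * L) (2 * R) e) (step L R d) (step L R d)
  step-intermediate {e} {d} il = interleaves even-cell odd-cell
    where
    even-cell : ∀ y → step (2 * L) (2 * R) e (+ 2 ℤ.* y) ≡ step L R d y
    even-cell y = begin
      step (2 * L) (2 * R) e (+ 2 ℤ.* y)
        ≡⟨ step-interleaved-even il y ⟩
      (intermediate d (y - + 1) ∨ step L R d y)
        ∧ not (nbhd (intermediate d) (y - + 1) ∧ nbhd (step L R d) y)
        ≡⟨ cong (λ w → (intermediate d (y - + 1) ∨ step L R d y) ∧ not (w ∧ nbhd (step L R d) y))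
             (nbhd-intermediate d (y - + 1)) ⟩
      (intermediate d (y - + 1) ∨ step L R d y) ∧ true
        ≡⟨ ∧-identityʳ _ ⟩
      (a ∧ not x) ∨ step L R d y
        ≡⟨ cong ((a ∧ not x) ∨_) (step≡split d y) ⟩
      (a ∧ not x) ∨ ((a ∨ b) ∧ not (x ∧ z))
        ≡⟨ step-absorbs-left a b x z ⟩
      (a ∨ b) ∧ not (x ∧ z)
        ≡⟨ sym (step≡split d y) ⟩
      step L R d y ∎
      where
      a = d (y - + 1)
      b = d y
      x = nbhd d (y - + 1)
      z = nbhd d y

    odd-cell : ∀ y → step (2 * L) (2 * R) e (+ 2 ℤ.* y + + 1) ≡ step L R d y
    odd-cell y = begin
      step (2 * L) (2 * R) e (+ 2 ℤ.* y + + 1)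
        ≡⟨ step-interleaved-odd il y ⟩
      (step L R d y ∨ intermediate d y) ∧ not (nbhd (step L R d) y ∧ nbhd (intermediate d) y)
        ≡⟨ cong (λ w → (step L R d y ∨ intermediate d y) ∧ not w)
             (trans (cong (nbhd (step L R d) y ∧_) (nbhd-intermediate d y)) (∧-zeroʳ _)) ⟩
      (step L R d y ∨ intermediate d y) ∧ true
        ≡⟨ ∧-identityʳ _ ⟩
      step L R d y ∨ (b ∧ not z)
        ≡⟨ cong (_∨ (b ∧ not z)) (step≡split d y) ⟩
      ((a ∨ b) ∧ not (x ∧ z)) ∨ (b ∧ not z)
        ≡⟨ step-absorbs-right a b x z ⟩
      (a ∨ b) ∧ not (x ∧ z)
        ≡⟨ sym (step≡split d y) ⟩
      step L R d y ∎
      where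
      a = d (y - + 1)
      b = d y
      x = nbhd d (y - + 1)
      z = nbhd d y

open Rule

≤⇒≡-distance : ∀ {a x} → a ℤ.≤ x → ∃[ k ] a ≡ x - + k
≤⇒≡-distance {a} {x} a≤x = ℤ.∣ x - a ∣ ,
  trans (a≡x-[x-a] x a) (cong (x -_) (sym (ℤP.0≤i⇒+∣i∣≡i (ℤP.i≤j⇒0≤j-i a≤x))))

lower-bound⇔ : ∀ x h j k → x - + h + + 1 + + j ℤ.≤ x - + k ⇔ j ℕ.+ k < h
lower-bound⇔ x h j k = mk⇔
  (λ le → ℤP.drop‿+≤+ (ℤP.0≤i-j⇒j≤i (subst (0ℤ ℤ.≤_) gap (ℤP.i≤j⇒0≤j-i le))))
  (λ lt → ℤP.0≤i-j⇒j≤i (subst (0ℤ ℤ.≤_) (sym gap) (ℤP.i≤j⇒0≤j-i (+≤+ lt))))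
  where
  gap = [x-k]-[x-h+1+j]≡h-[1+j+k] x (+ h) (+ j) (+ k)

interval⇔ : ∀ (P : ℤ → Set) x h j →
  (∀ a → x - + h + + 1 + + j ℤ.≤ a → a ℤ.≤ x → P a) ⇔ (∀ k → j ℕ.+ k < h → P (x - + k))
interval⇔ P x h j = mk⇔
  (λ onInterval k lt → onInterval (x - + k) (from (lower-bound⇔ x h j k) lt) (ℤP.i-j≤i x (+ k)))
  (λ onOffsets a lo a≤x → let (k , a≡x-k) = ≤⇒≡-distance a≤x in
    subst P (sym a≡x-k) (onOffsets k (to (lower-bound⇔ x h j k) (subst (_ ℤ.≤_) a≡x-k lo))))

history : ℕ → ℕ → Config → ℕ → Config
history L R I t x = CA L R I x t

-- Cell (x - k, y + j) lies in T(x, y, h) iff j + k < h.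
ZeroTriangle : (ℕ → Config) → ℤ → ℕ → ℕ → Set
ZeroTriangle row x y h = ∀ j k → j ℕ.+ k < h → row (y ℕ.+ j) (x - + k) ≡ false

FullBase : ℕ → ℕ → Config → ℤ → ℕ → Set
FullBase L R c x h = ∀ k → k < h → allOnesW1 L R c (x - + k) ≡ true

CASafe⇔ : ∀ L R I x y h → CASafe L R I x y h ⇔
  (ZeroTriangle (history L R I) x y h × (∀ y' → y ≡ suc y' → FullBase L R (history L R I y') x h))
CASafe⇔ L R I x y h = mk⇔
  (λ (zero-cells , full-windows) →
    (λ j k lt → to (interval⇔ (λ a → CA L R I a (y ℕ.+ j) ≡ false) x h j)
                  (λ a lo hi → zero-cells a (y ℕ.+ j) (j , ℕP.m+n≤o⇒m≤o (suc j) lt , refl , lo , hi))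
                  k lt) ,
    (λ y' y≡1+y' k k<h → to (zerosW1≡0⇔ L R (history L R I y') (x - + k))
       (to (interval⇔ (λ a → zerosW1 L R (history L R I y') a ≡ 0) x h 0)
           (λ a lo → full-windows y' y≡1+y' a (subst (ℤ._≤ a) (ℤP.+-identityʳ _) lo)) k k<h)))
  (λ (zero-triangle , full-base) →
    (λ { a .(y ℕ.+ j) (j , _ , refl , lo , hi) →
         from (interval⇔ (λ a → CA L R I a (y ℕ.+ j) ≡ false) x h j) (zero-triangle j) a lo hi }) ,
    (λ y' y≡1+y' a lo → from (interval⇔ (λ a → zerosW1 L R (history L R I y') a ≡ 0) x h 0)
       (λ k k<h → from (zerosW1≡0⇔ L R (history L R I y') (x - + k)) (full-base y' y≡1+y' k k<h))
       a (subst (ℤ._≤ a) (sym (ℤP.+-identityʳ _)) lo)))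

fullBase⇒nbhd : ∀ L R d u H → FullBase L R d u H → ∀ b → b < H → nbhd L R d (u - + suc b) ≡ true
fullBase⇒nbhd L R d u H full b b<H = trans (cong (nbhd L R d) (u-[1+b]≡u-b-1 u (+ b)))
  (allOnesW1⇒nbhd-pred L R d (u - + b) (full b b<H))

fullBase-doubled : ∀ L R {c d} → Interleaves c d d → ∀ u H →
  FullBase L R d u H ⇔ FullBase (2 * L) (2 * R) c (+ 2 ℤ.* u) (2 * H)
fullBase-doubled L R {c} {d} il u H = mk⇔ doubled halved
  where
  at-even : ∀ b → allOnesW1 (2 * L) (2 * R) c (+ 2 ℤ.* u - + (2 * b)) ≡ allOnesW1 L R d (u - + b)
  at-even b = trans (cong (allOnesW1 (2 * L) (2 * R) c) (even-position u b))
                    (allOnesW1-doubled-even L R il (u - + b))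

  doubled : FullBase L R d u H → FullBase (2 * L) (2 * R) c (+ 2 ℤ.* u) (2 * H)
  doubled full k k<2H with evenOdd k
  ... | even b = trans (at-even b) (full b (halve b k<2H 0 (ℕP.+-identityʳ _)))
  ... | odd  b = trans (cong (allOnesW1 (2 * L) (2 * R) c) (odd-position u b))
    (trans (allOnesW1-doubled-odd L R il (u - + suc b))
           (fullBase⇒nbhd L R d u H full b (halve b k<2H 1 (ℕP.+-comm _ 1))))

  halved : FullBase (2 * L) (2 * R) c (+ 2 ℤ.* u) (2 * H) → FullBase L R d u H
  halved full k k<H = trans (sym (at-even k)) (full (2 * k) (ℕP.*-monoʳ-< 2 k<H))

module Doubling (L R : ℕ) (I0 I1 : Config) (I1-doubles : Interleaves I1 I0 I0) (u : ℤ) where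

  D : ℕ → Config
  D = history L R I0

  C : ℕ → Config
  C = history (2 * L) (2 * R) I1

  C-even : ∀ t → Interleaves (C (2 * t)) (D t) (D t)
  C-odd  : ∀ t → Interleaves (C (suc (2 * t))) (D (suc t)) (intermediate L R (D t))
  C-even zero    = I1-doubles
  C-even (suc t) = subst (λ s → Interleaves (C s) (D (suc t)) (D (suc t))) (sym (ℕP.*-suc 2 t))
                         (step-intermediate L R {d = D t} (C-odd t))
  C-odd t = step-doubled L R (C-even t)

  C-even-at : ∀ {s} t → s ≡ 2 * t → Interleaves (C s) (D t) (D t)
  C-even-at t refl = C-even t

  C-odd-at : ∀ {s} t → s ≡ suc (2 * t) → Interleaves (C s) (D (suc t)) (intermediate L R (D t))
  C-odd-at t refl = C-odd t

  zeroTriangle₀-doubled : ∀ h → ZeroTriangle D u 0 (suc h) → ZeroTriangle C (+ 2 ℤ.* u) 0 (suc (2 * h))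
  zeroTriangle₀-doubled h zero-cells j k j+k≤2h with evenOdd j | evenOdd k
  ... | even a | even b = trans (interleaved-at-even (C-even a) u b)
    (zero-cells a b (halve (a ℕ.+ b) (n<1+2h⇒1+n<2[1+h] j+k≤2h) 1 (solve (a ∷ b ∷ []))))
  ... | even a | odd  b = trans (interleaved-at-odd (C-even a) u b)
    (zero-cells a (suc b) (halve (a ℕ.+ suc b) (n<1+2h⇒1+n<2[1+h] j+k≤2h) 0 (solve (a ∷ b ∷ []))))
  ... | odd  a | even b = trans (interleaved-at-even (C-odd a) u b)
    (zero-cells (suc a) b (halve (suc a ℕ.+ b) (n<1+2h⇒1+n<2[1+h] j+k≤2h) 0 (solve (a ∷ b ∷ []))))
  ... | odd  a | odd  b = trans (interleaved-at-odd (C-odd a) u b) (cong (_∧ not (nbhd L R (D a) (u - + suc b)))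
    (zero-cells a (suc b) (halve (a ℕ.+ suc b) (n<1+2h⇒1+n<2[1+h] j+k≤2h) 1 (solve (a ∷ b ∷ [])))))

  zeroTriangle₀-halved : ∀ h → ZeroTriangle C (+ 2 ℤ.* u) 0 (suc (2 * h)) → ZeroTriangle D u 0 (suc h)
  zeroTriangle₀-halved h zero-cells j k j+k≤h = trans (sym (interleaved-at-even (C-even j) u k))
    (zero-cells (2 * j) (2 * k)
      (s≤s (subst (_≤ 2 * h) (ℕP.*-distribˡ-+ 2 j k) (ℕP.*-monoʳ-≤ 2 (s≤s⁻¹ j+k≤h)))))

  zeroTriangle-doubled : ∀ v H → ZeroTriangle D u (suc v) H → FullBase L R (D v) u H →
    ZeroTriangle C (+ 2 ℤ.* u) (suc (2 * v)) (2 * H)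
  zeroTriangle-doubled v H zero-cells full j k j+k<2H with evenOdd j | evenOdd k
  ... | odd a | even b =
    trans (interleaved-at-even (C-even-at (suc v ℕ.+ a) (1+2v+[1+2a]≡2[1+v+a] v a)) u b)
          (zero-cells a b (halve (a ℕ.+ b) j+k<2H 1 (solve (a ∷ b ∷ []))))
  ... | odd a | odd b =
    trans (interleaved-at-odd (C-even-at (suc v ℕ.+ a) (1+2v+[1+2a]≡2[1+v+a] v a)) u b)
          (zero-cells a (suc b) (halve (a ℕ.+ suc b) j+k<2H 0 (solve (a ∷ b ∷ []))))
  ... | even a | even b =
    trans (interleaved-at-even (C-odd-at (v ℕ.+ a) (1+2v+2a≡1+2[v+a] v a)) u b)
          (zero-cells a b (halve (a ℕ.+ b) j+k<2H 0 (solve (a ∷ b ∷ []))))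
  ... | even zero | odd b =
    trans (interleaved-at-odd (C-odd-at v (ℕP.+-identityʳ _)) u b)
          (trans (cong (λ w → D v (u - + suc b) ∧ not w)
                       (fullBase⇒nbhd L R (D v) u H full b (halve b j+k<2H 1 (ℕP.+-comm _ 1))))
                 (∧-zeroʳ _))
  ... | even (suc a) | odd b =
    trans (interleaved-at-odd (C-odd-at (v ℕ.+ suc a) (1+2v+2a≡1+2[v+a] v (suc a))) u b)
          (cong (_∧ not (nbhd L R (D (v ℕ.+ suc a)) (u - + suc b)))
                (trans (cong (λ t → D t (u - + suc b)) (ℕP.+-suc v a))
                       (zero-cells a (suc b) (halve (a ℕ.+ suc b) j+k<2H 1 (solve (a ∷ b ∷ []))))))

  zeroTriangle-halved : ∀ v H → ZeroTriangle C (+ 2 ℤ.* u) (suc (2 * v)) (2 * H) → ZeroTriangle D u (suc v) H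
  zeroTriangle-halved v H zero-cells a b a+b<H =
    trans (sym (interleaved-at-even (C-even-at (suc v ℕ.+ a) (1+2v+[1+2a]≡2[1+v+a] v a)) u b))
          (zero-cells (suc (2 * a)) (2 * b)
            (subst (_< 2 * H) (cong suc (ℕP.*-distribˡ-+ 2 a b)) (suc-double-< a+b<H)))

  safe-level0 : ∀ h → CASafe L R I0 u 0 (suc h) ⇔ CASafe (2 * L) (2 * R) I1 (+ 2 ℤ.* u) 0 (suc (2 * h))
  safe-level0 h = mk⇔
    (λ safe → from T₂⇔ (zeroTriangle₀-doubled h (proj₁ (to T₁⇔ safe)) , λ _ ()))
    (λ safe → from T₁⇔ (zeroTriangle₀-halved h (proj₁ (to T₂⇔ safe)) , λ _ ()))
    where
    T₁⇔ = CASafe⇔ L R I0 u 0 (suc h)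
    T₂⇔ = CASafe⇔ (2 * L) (2 * R) I1 (+ 2 ℤ.* u) 0 (suc (2 * h))

  safe-levelSuc : ∀ v H →
    CASafe L R I0 u (suc v) H ⇔ CASafe (2 * L) (2 * R) I1 (+ 2 ℤ.* u) (suc (2 * v)) (2 * H)
  safe-levelSuc v H = mk⇔
    (λ safe → let (zero-cells , full) = to T₁⇔ safe in
      from T₂⇔ (zeroTriangle-doubled v H zero-cells (full v refl) ,
                λ { _ refl → to (fullBase-doubled L R (C-even v) u H) (full v refl) }))
    (λ safe → let (zero-cells , full) = to T₂⇔ safe in
      from T₁⇔ (zeroTriangle-halved v H zero-cells ,
                λ { _ refl → from (fullBase-doubled L R (C-even v) u H) (full (2 * v) refl) }))
    where
    T₁⇔ = CASafe⇔ L R I0 u (suc v) H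
    T₂⇔ = CASafe⇔ (2 * L) (2 * R) I1 (+ 2 ℤ.* u) (suc (2 * v)) (2 * H)

theorem2 : (L R : ℕ) (I0 I1 : ℤ → Bool) →
    (∀ x → I1 (+ 2 ℤ.* x) ≡ I0 x × I1 (+ 2 ℤ.* x + + 1) ≡ I0 x) →
    (u : ℤ) (v h : ℕ) → 1 ≤ h →
    (v ≡ 0 →
      CASafe L R I0 u v h ⇔ CASafe (2 * L) (2 * R) I1 (+ 2 ℤ.* u) 0 (2 * h ∸ 1)) ×
    (∀ v' → v ≡ suc v' →
      CASafe L R I0 u v h ⇔ CASafe (2 * L) (2 * R) I1 (+ 2 ℤ.* u) (2 * v ∸ 1) (2 * h))
theorem2 L R I0 I1 I1-doubles u v (suc h) (s≤s z≤n) = base-level , higher-level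
  where
  open Doubling L R I0 I1 (interleaves (proj₁ ∘ I1-doubles) (proj₂ ∘ I1-doubles)) u

  base-level : v ≡ 0 →
    CASafe L R I0 u v (suc h) ⇔ CASafe (2 * L) (2 * R) I1 (+ 2 ℤ.* u) 0 (2 * suc h ∸ 1)
  base-level refl = subst (λ n → CASafe L R I0 u 0 (suc h) ⇔ CASafe (2 * L) (2 * R) I1 (+ 2 ℤ.* u) 0 n)
    (sym (2[1+n]∸1≡1+2n h)) (safe-level0 h)

  higher-level : ∀ v' → v ≡ suc v' →
    CASafe L R I0 u v (suc h) ⇔ CASafe (2 * L) (2 * R) I1 (+ 2 ℤ.* u) (2 * v ∸ 1) (2 * suc h)
  higher-level v' refl = subst
    (λ n → CASafe L R I0 u (suc v') (suc h) ⇔ CASafe (2 * L) (2 * R) I1 (+ 2 ℤ.* u) n (2 * suc h))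
    (sym (2[1+n]∸1≡1+2n v')) (safe-levelSuc v' (suc h))
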